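{- Algorithm 2 (described in the context) is a 4-approximation algorithm for min-max 2-TSP: for every instance, the returned tours $C_b,C_r$ satisfy $\max\{c(C_b),c(C_r)\}\le 4\cdot\mathrm{OPT}_{mm}$, where $\mathrm{OPT}_{mm}$ is the minimum of $\max\{c(R),c(B)\}$ over all feasible solutions.
   Context: An instance of 2-TSP consists of $2n$ nodes $V$ (with $n$ even) partitioned into $n$ pairs $\{p_i,q_i\}$, with metric edge weights $c$ on the complete graph on $V$ (nonnegative, triangle inequality). A feasible solution colors one node of each pair red and the other blue, and consists of a tour (Hamiltonian cycle) $R$ on the red nodes and a tour $B$ on the blue nodes; the min-max objective minimizes $\max\{c(R),c(B)\}$, with $c(F)$ the total weight of edge set $F$. Algorithm 2: (1) compute a minimum spanning tree $T$ on all $2n$ nodes; (2) delete a maximum-weight edge $e_\times$ of $T$, obtaining trees $T_L,T_R$ on node sets $V_L,V_R$; (3) for each pair with one node in $V_L$ and the other in $V_R$, color the node in $V_L$ blue and the node in $V_R$ red; (4) for every other pair, assign its nodes arbitrary distinct colors; (5) compute a tour $C$ of all nodes from $T$ by edge-doubling (Eulerian circuit of the doubled tree, shortcutting repeated nodes); (6) for each color $c\in\{b,r\}$, let $C_c$ be the tour of the color-$c$ nodes obtained by shortcutting $C$; return $\{C_b,C_r\}$.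
   Formalization: The edge weights $c$ of each instance take values in the rationals. -}

module Defs where

open import Data.Nat using (ℕ)
open import Data.Fin using (Fin)
import Data.Fin.Properties as FinP
open import Data.Bool using (Bool; true; false; not)
import Data.Bool.Properties as BoolP
open import Data.Product using (_×_; _,_; Σ; ∃; ∃-syntax; proj₁; proj₂)
open import Data.Product.Properties using (≡-dec)
open import Data.Sum using (_⊎_)
open import Data.List using (List; []; _∷_; _++_; length; filter; deduplicate; removeAt; lookup; map; foldr)
open import Data.List.Membership.Propositional using (_∈_)
open import Data.List.Relation.Unary.Unique.Propositional using (Unique)
open import Data.List.Relation.Binary.Permutation.Propositional using (_↭_)
open import Data.List.Relation.Binary.Pointwise using (Pointwise)
open import Data.Integer using (+_)
open import Data.Rational using (ℚ; 0ℚ; _+_; _*_; _≤_; _⊔_; _/_)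
open import Relation.Binary.PropositionalEquality using (_≡_)
open import Relation.Nullary using (¬_; ¬?)
open import Relation.Binary.Definitions using (DecidableEquality)

-- The 2n nodes: (i , false) is p_i and (i , true) is q_i; the pairs are {(i,false),(i,true)}.
Node : ℕ → Set
Node n = Fin n × Bool

_≟N_ : ∀ {n} → DecidableEquality (Node n)
_≟N_ = ≡-dec FinP._≟_ BoolP._≟_

-- an (undirected) edge {u,v}, written as an ordered pair
Edge : ℕ → Set
Edge n = Node n × Node n

-- edge weights on the complete graph (diagonal set to 0 by convention)
Weight : ℕ → Set
Weight n = Node n → Node n → ℚ

record IsMetric {n : ℕ} (c : Weight n) : Set where
  field
    nonneg   : ∀ u v → 0ℚ ≤ c u v
    diag     : ∀ u → c u u ≡ 0ℚ
    symm     : ∀ u v → c u v ≡ c v u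
    triangle : ∀ u v w → c u w ≤ c u v + c v w

sumℚ : List ℚ → ℚ
sumℚ = foldr _+_ 0ℚ

edgeWeight : ∀ {n} → Weight n → Edge n → ℚ
edgeWeight c (u , v) = c u v

weight : ∀ {n} → Weight n → List (Edge n) → ℚ
weight c F = sumℚ (map (edgeWeight c) F)

four : ℚ
four = + 4 / 1

data Reach {n : ℕ} (F : List (Edge n)) : Node n → Node n → Set where
  here : ∀ {u} → Reach F u u
  step : ∀ {u v w} → ((u , v) ∈ F ⊎ (v , u) ∈ F) → Reach F v w → Reach F u w

Connected : ∀ {n} → List (Edge n) → Set
Connected F = ∀ u v → Reach F u v

-- no cycle: no edge of F has its endpoints connected in F without that edge
Acyclic : ∀ {n} → List (Edge n) → Set
Acyclic F = ∀ (k : Fin (length F)) →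
  ¬ Reach (removeAt F k) (proj₁ (lookup F k)) (proj₂ (lookup F k))

IsSpanningTree : ∀ {n} → List (Edge n) → Set
IsSpanningTree F = Connected F × Acyclic F

IsMST : ∀ {n} → Weight n → List (Edge n) → Set
IsMST c T = IsSpanningTree T × (∀ T' → IsSpanningTree T' → weight c T ≤ weight c T')

IsMaxEdge : ∀ {n} → Weight n → (T : List (Edge n)) → Fin (length T) → Set
IsMaxEdge c T k = ∀ j → edgeWeight c (lookup T j) ≤ edgeWeight c (lookup T k)

-- col i is the side of pair i that is colored red; the other node of pair i is blue
Coloring : ℕ → Set
Coloring n = Fin n → Bool

IsRed : ∀ {n} → Coloring n → Node n → Set
IsRed col (i , b) = b ≡ col i

IsBlue : ∀ {n} → Coloring n → Node n → Set
IsBlue col (i , b) = ¬ (b ≡ col i)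

redPart : ∀ {n} → Coloring n → List (Node n) → List (Node n)
redPart col = filter (λ x → proj₂ x BoolP.≟ col (proj₁ x))

bluePart : ∀ {n} → Coloring n → List (Node n) → List (Node n)
bluePart col = filter (λ x → ¬? (proj₂ x BoolP.≟ col (proj₁ x)))

-- Step 3: after deleting edge k = (u , v) of T, V_L is the vertex set of the
-- component of u and V_R that of v.  Every pair split between V_L and V_R
-- has its V_L-node blue (and hence its V_R-node red).  Other pairs: arbitrary.
RespectsCut : ∀ {n} → (T : List (Edge n)) → Fin (length T) → Coloring n → Set
RespectsCut T k col =
  ∀ i b → Reach (removeAt T k) (proj₁ (lookup T k)) (i , b)
        → ¬ Reach (removeAt T k) (proj₁ (lookup T k)) (i , not b)
        → IsBlue col (i , b)

walkSteps : ∀ {n} → List (Node n) → List (Edge n)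
walkSteps []             = []
walkSteps (a ∷ [])       = []
walkSteps (a ∷ b ∷ rest) = (a , b) ∷ walkSteps (b ∷ rest)

SameEdge : ∀ {n} → Edge n → Edge n → Set
SameEdge (a , b) (u , v) = (a ≡ u × b ≡ v) ⊎ (a ≡ v × b ≡ u)

Closed : ∀ {n} → List (Node n) → Set
Closed W = ∃[ x ] (W ≡ x ∷ [] ⊎ ∃[ zs ] W ≡ x ∷ zs ++ x ∷ [])

-- W is an Eulerian circuit of the multigraph D: a closed walk using every
-- edge of D exactly once (in either direction)
EulerCircuit : ∀ {n} → List (Edge n) → List (Node n) → Set
EulerCircuit D W = Closed W × ∃[ E ] (E ↭ D × Pointwise SameEdge (walkSteps W) E)

shortcut : ∀ {n} → List (Node n) → List (Node n)
shortcut = deduplicate _≟N_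

cycleSteps : ∀ {n} → List (Node n) → List (Edge n)
cycleSteps []       = []
cycleSteps (x ∷ xs) = go (x ∷ xs)
  where
  go : List _ → List _
  go []            = []
  go (a ∷ [])      = (a , x) ∷ []
  go (a ∷ b ∷ rest) = (a , b) ∷ go (b ∷ rest)

-- c(tour) for a tour given as the cyclic order of its nodes
tourCost : ∀ {n} → Weight n → List (Node n) → ℚ
tourCost c L = weight c (cycleSteps L)

IsTourOn : ∀ {n} → (Node n → Set) → List (Node n) → Set
IsTourOn P L = Unique L × (∀ x → (x ∈ L → P x) × (P x → x ∈ L))

record Feasible (n : ℕ) : Set where
  field
    coloring : Coloring n
    R        : List (Node n)
    B        : List (Node n)
    R-tour   : IsTourOn (IsRed coloring) R
    B-tour   : IsTourOn (IsBlue coloring) B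

mmCost : ∀ {n} → Weight n → Feasible n → ℚ
mmCost c s = tourCost c (Feasible.R s) ⊔ tourCost c (Feasible.B s)

module Submission where

-- Let T be the minimum spanning tree, (u , v) its deleted maximum edge, T′ the rest of T,
-- S the side of u in T′, and (X , Y) the red and blue tours of any feasible solution.
-- Shortcutting an Euler circuit of the doubled tree costs at most twice the tree, also
-- after collapsing some nodes to one (TourCost.shortcut-bound).  Two cases:
--  (1) some edge (p , q) of X or Y crosses the cut.  Then c(T) ≤ c(X) + c(Y): removing
--      (p , q) from its tour and joining the resulting path to a path through the other
--      tour by a tree edge gives a spanning tree, and that tree edge costs at most
--      c u v ≤ c p q (maximality of (u , v) and the cut property).
--  (2) no tour edge crosses.  Then S is the node set of one tour, so S is entirely blue
--      and its complement red; the two paths joined by (u , v) show c(T′) ≤ c(X) + c(Y),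
--      and collapsing the other colour onto a single node shows that each returned
--      tour costs at most 2 c(T′).
-- Either way both returned tours cost at most 2 (c(X) + c(Y)) ≤ 4 max(c(X), c(Y)).  Decidability of S, needed for the case
-- split, is obtained classically; this is harmless since the goal is a decidable inequality.

open import Defs
open import Data.Bool using (not; false; true)
import Data.Bool.Properties as Bool
open import Data.Empty using (⊥; ⊥-elim)
open import Data.Fin using (Fin; zero; suc)
open import Data.List using (List; []; _∷_; _++_; length; filter; deduplicate; removeAt; lookup; map)
import Data.List.Properties as List
open import Data.List.Membership.Propositional using (_∈_; find; lose)
open import Data.List.Membership.Propositional.Properties using (∈-lookup; ∈-++⁺ˡ; ∈-++⁺ʳ; ∈-++⁻)
open import Data.List.Relation.Binary.Permutation.Propositional using (_↭_; ↭⇒↭ₛ; ↭-sym)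
import Data.List.Relation.Binary.Permutation.Propositional.Properties as Perm
import Data.List.Relation.Binary.Permutation.Setoid.Properties as PermₛProps
open import Data.List.Relation.Binary.Pointwise using (Pointwise; []; _∷_)
open import Data.List.Relation.Binary.Sublist.Propositional using ([]; _∷_; _∷ʳ_; ⊆-trans) renaming (_⊆_ to _⊑_)
open import Data.List.Relation.Binary.Sublist.Propositional.Properties using (filter-⊆; filter⁺)
open import Data.List.Relation.Binary.Subset.Propositional using (_⊆_)
open import Data.List.Relation.Unary.All using ([]; _∷_)
open import Data.List.Relation.Unary.All.Properties using (All¬⇒¬Any)
open import Data.List.Relation.Unary.AllPairs using ([]; _∷_)
open import Data.List.Relation.Unary.Any using (here; there; any?; index)
open import Data.List.Relation.Unary.Any.Properties using (lookup-index)
open import Data.List.Relation.Unary.Unique.Propositional using (Unique)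
open import Data.Nat using (ℕ)
import Data.Nat as ℕ
open import Data.Nat.Divisibility using (_∣_)
open import Data.Product using (_×_; _,_; Σ; ∃-syntax; proj₁; proj₂)
import Data.Product
open import Data.Rational using (ℚ; 0ℚ; 1ℚ; _≤_; _+_; _*_; -_; _⊔_)
import Data.Rational.Properties as ℚ
open import Data.Sum using (_⊎_; inj₁; inj₂)
import Data.Sum
open import Function using (_∘_; id)
open import Relation.Binary.PropositionalEquality
  using (_≡_; refl; sym; trans; cong; cong₂; subst; subst₂; setoid; module ≡-Reasoning)
open import Relation.Nullary using (¬_; Dec; yes; no; ¬?)
open import Relation.Nullary.Decidable using (_×-dec_; _⊎-dec_; decidable-stable; ¬¬-excluded-middle)

sumOf : ∀ {A : Set} → (A → ℚ) → List A → ℚ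
sumOf h L = sumℚ (map h L)

module _ {A : Set} (h : A → ℚ) where

  sumOf-++ : ∀ X Y → sumOf h (X ++ Y) ≡ sumOf h X + sumOf h Y
  sumOf-++ []      Y = sym (ℚ.+-identityˡ _)
  sumOf-++ (x ∷ X) Y = trans (cong (h x +_) (sumOf-++ X Y)) (sym (ℚ.+-assoc (h x) _ _))

  sumOf-↭ : ∀ {X Y} → X ↭ Y → sumOf h X ≡ sumOf h Y
  sumOf-↭ p = PermₛProps.foldr-commMonoid (setoid ℚ) ℚ.+-0-isCommutativeMonoid (↭⇒↭ₛ (Perm.map⁺ h p))

  sumOf-removeAt : ∀ L k → sumOf h L ≡ h (lookup L k) + sumOf h (removeAt L k)
  sumOf-removeAt (x ∷ L) zero    = refl
  sumOf-removeAt (x ∷ L) (suc k) = begin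
    h x + sumOf h L                                         ≡⟨ cong (h x +_) (sumOf-removeAt L k) ⟩
    h x + (h (lookup L k) + sumOf h (removeAt L k))         ≡⟨ sym (ℚ.+-assoc (h x) _ _) ⟩
    (h x + h (lookup L k)) + sumOf h (removeAt L k)         ≡⟨ cong (_+ sumOf h (removeAt L k)) (ℚ.+-comm (h x) _) ⟩
    (h (lookup L k) + h x) + sumOf h (removeAt L k)         ≡⟨ ℚ.+-assoc (h (lookup L k)) (h x) _ ⟩
    h (lookup L k) + (h x + sumOf h (removeAt L k))         ∎
    where open ≡-Reasoning

  sumOf-nonneg : (∀ x → 0ℚ ≤ h x) → ∀ L → 0ℚ ≤ sumOf h L
  sumOf-nonneg h≥0 []      = ℚ.≤-refl
  sumOf-nonneg h≥0 (x ∷ L) = ℚ.+-mono-≤ (h≥0 x) (sumOf-nonneg h≥0 L)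

sumOf-mono : ∀ {A : Set} (h h′ : A → ℚ) L → (∀ {x} → x ∈ L → h x ≤ h′ x) → sumOf h L ≤ sumOf h′ L
sumOf-mono h h′ []      h≤h′ = ℚ.≤-refl
sumOf-mono h h′ (x ∷ L) h≤h′ = ℚ.+-mono-≤ (h≤h′ (here refl)) (sumOf-mono h h′ L (λ x∈ → h≤h′ (there x∈)))

+-cancelʳ-≤ : ∀ a b w → a + w ≤ b + w → a ≤ b
+-cancelʳ-≤ a b w a+w≤b+w = subst₂ _≤_ (remove a) (remove b) (ℚ.+-monoˡ-≤ (- w) a+w≤b+w)
  where
  remove : ∀ x → (x + w) + - w ≡ x
  remove x = trans (ℚ.+-assoc x w (- w)) (trans (cong (x +_) (ℚ.+-inverseʳ w)) (ℚ.+-identityʳ x))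

module _ {A : Set} where

  removeAt-⊆ : ∀ (L : List A) k → removeAt L k ⊆ L
  removeAt-⊆ (x ∷ L) zero    e∈         = there e∈
  removeAt-⊆ (x ∷ L) (suc k) (here e≡)  = here e≡
  removeAt-⊆ (x ∷ L) (suc k) (there e∈) = there (removeAt-⊆ L k e∈)

  ∈-removeAt : ∀ (L : List A) k {e} → e ∈ L → e ≡ lookup L k ⊎ e ∈ removeAt L k
  ∈-removeAt (x ∷ L) zero    (here e≡)  = inj₁ e≡
  ∈-removeAt (x ∷ L) zero    (there e∈) = inj₂ e∈
  ∈-removeAt (x ∷ L) (suc k) (here e≡)  = inj₂ (here e≡)
  ∈-removeAt (x ∷ L) (suc k) (there e∈) = Data.Sum.map₂ there (∈-removeAt L k e∈)

  removeAt-removeAt : ∀ (L : List A) k (j : Fin (length (removeAt L k))) →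
    Σ (Fin (length L)) λ j′ → lookup L j′ ≡ lookup (removeAt L k) j × removeAt (removeAt L k) j ⊆ removeAt L j′
  removeAt-removeAt (x ∷ L) zero    j       = suc j , refl , there
  removeAt-removeAt (x ∷ L) (suc k) zero    = zero , refl , removeAt-⊆ L k
  removeAt-removeAt (x ∷ L) (suc k) (suc j) with removeAt-removeAt L k j
  ... | j′ , same , ⊆L = suc j′ , same , λ { (here e≡) → here e≡ ; (there e∈) → there (⊆L e∈) }

module Graph {n : ℕ} where

  private variable
    F G : List (Edge n)
    U V P : Node n → Set
    a b p q x y : Node n

  Adj : List (Edge n) → Node n → Node n → Set
  Adj F x y = (x , y) ∈ F ⊎ (y , x) ∈ F

  reach-trans : Reach F a b → Reach F b x → Reach F a x
  reach-trans here       r = r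
  reach-trans (step e s) r = step e (reach-trans s r)

  reach-sym : Reach F a b → Reach F b a
  reach-sym here              = here
  reach-sym (step (inj₁ e) r) = reach-trans (reach-sym r) (step (inj₂ e) here)
  reach-sym (step (inj₂ e) r) = reach-trans (reach-sym r) (step (inj₁ e) here)

  reach-mono : F ⊆ G → Reach F a b → Reach G a b
  reach-mono F⊆G here              = here
  reach-mono F⊆G (step (inj₁ e) r) = step (inj₁ (F⊆G e)) (reach-mono F⊆G r)
  reach-mono F⊆G (step (inj₂ e) r) = step (inj₂ (F⊆G e)) (reach-mono F⊆G r)

  -- P is a union of connected components of F
  Invariant : List (Edge n) → (Node n → Set) → Set
  Invariant F P = ∀ {x y} → (x , y) ∈ F → (P x → P y) × (P y → P x)

  invariant-reach : Invariant F P → Reach F a b → P a → P b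
  invariant-reach inv here              Pa = Pa
  invariant-reach inv (step (inj₁ e) r) Pa = invariant-reach inv r (proj₁ (inv e) Pa)
  invariant-reach inv (step (inj₂ e) r) Pa = invariant-reach inv r (proj₂ (inv e) Pa)

  component-invariant : ∀ a → Invariant F (Reach F a)
  component-invariant a e = (λ r → reach-trans r (step (inj₁ e) here)) , (λ r → reach-trans r (step (inj₂ e) here))

  invariant-⇔ : (∀ {z} → P z → U z) → (∀ {z} → U z → P z) → Invariant F P → Invariant F U
  invariant-⇔ P⇒U U⇒P inv e = (λ Ux → P⇒U (proj₁ (inv e) (U⇒P Ux))) , (λ Uy → P⇒U (proj₂ (inv e) (U⇒P Uy)))

  invariant-¬ : Invariant F P → Invariant F (λ z → ¬ P z)
  invariant-¬ inv e = (λ ¬Px Py → ¬Px (proj₂ (inv e) Py)) , (λ ¬Py Px → ¬Py (proj₁ (inv e) Px))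

  Within : (Node n → Set) → List (Edge n) → Set
  Within U F = ∀ {x y} → (x , y) ∈ F → U x × U y

  Disjoint : (Node n → Set) → (Node n → Set) → Set
  Disjoint U V = ∀ {z} → U z → V z → ⊥

  adj-within : Within U F → Adj F x y → U x × U y
  adj-within w (inj₁ e) = w e
  adj-within w (inj₂ e) = proj₂ (w e) , proj₁ (w e)

  reach-within : Within U F → U a → Reach F a b → U b
  reach-within w Ua r = invariant-reach (λ e → (λ _ → proj₂ (w e)) , (λ _ → proj₁ (w e))) r Ua

  isolated : Within U F → ¬ U a → Reach F a b → a ≡ b
  isolated w ¬Ua here       = refl
  isolated w ¬Ua (step e r) = ⊥-elim (¬Ua (proj₁ (adj-within w e)))

  adj-++⁻ : ∀ F → Adj (F ++ G) x y → Adj F x y ⊎ Adj G x y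
  adj-++⁻ F (inj₁ e) = Data.Sum.map inj₁ inj₁ (∈-++⁻ F e)
  adj-++⁻ F (inj₂ e) = Data.Sum.map inj₂ inj₂ (∈-++⁻ F e)

  reach-restrict : Within U F → Within V G → Disjoint U V → U a → Reach (F ++ G) a b → Reach F a b
  reach-restrict wF wG UV Ua here = here
  reach-restrict {F = F} wF wG UV Ua (step e r) with adj-++⁻ F e
  ... | inj₁ eF = step eF (reach-restrict wF wG UV (proj₂ (adj-within wF eF)) r)
  ... | inj₂ eG = ⊥-elim (UV Ua (proj₁ (adj-within wG eG)))

  -- Adding an edge (a , b) between two sides of an invariant P cannot join nodes
  -- p, q on a common side that F keeps apart: every walk from p in (a , b) ∷ F
  -- uses the new edge at most once, so it is captured by the predicate Q below.
  add-bridge : Invariant F P → P a → ¬ P b → (P p → P q) → (P q → P p) →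
               ¬ Reach F p q → ¬ Reach ((a , b) ∷ F) p q
  add-bridge {F} {P} {a} {b} {p} {q} inv Pa ¬Pb pq qp ¬pq r = excluded (invariant-reach closed r (inj₁ here))
    where
    Q : Node n → Set
    Q z = Reach F p z ⊎ (Reach F p a × Reach F b z) ⊎ (Reach F p b × Reach F a z)
    extend : ∀ {x y} → Reach F x y → Q x → Q y
    extend s (inj₁ r₁)               = inj₁ (reach-trans r₁ s)
    extend s (inj₂ (inj₁ (r₁ , r₂))) = inj₂ (inj₁ (r₁ , reach-trans r₂ s))
    extend s (inj₂ (inj₂ (r₁ , r₂))) = inj₂ (inj₂ (r₁ , reach-trans r₂ s))
    cross-ab : Q a → Q b
    cross-ab (inj₁ r₁)               = inj₂ (inj₁ (r₁ , here))
    cross-ab (inj₂ (inj₁ (r₁ , _)))  = inj₂ (inj₁ (r₁ , here))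
    cross-ab (inj₂ (inj₂ (r₁ , _)))  = inj₁ r₁
    cross-ba : Q b → Q a
    cross-ba (inj₁ r₁)               = inj₂ (inj₂ (r₁ , here))
    cross-ba (inj₂ (inj₁ (r₁ , _)))  = inj₁ r₁
    cross-ba (inj₂ (inj₂ (r₁ , _)))  = inj₂ (inj₂ (r₁ , here))
    closed : Invariant ((a , b) ∷ F) Q
    closed (here refl) = cross-ab , cross-ba
    closed (there e)   = extend (step (inj₁ e) here) , extend (step (inj₂ e) here)
    excluded : ¬ Q q
    excluded (inj₁ r₁) = ¬pq r₁
    excluded (inj₂ (inj₁ (r₁ , r₂))) =
      ¬Pb (invariant-reach inv (reach-sym r₂) (pq (invariant-reach inv (reach-sym r₁) Pa)))
    excluded (inj₂ (inj₂ (r₁ , r₂))) =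
      ¬Pb (invariant-reach inv r₁ (qp (invariant-reach inv r₂ Pa)))

  -- adding an edge between two components keeps a graph acyclic; for the old edges,
  -- add-bridge applies with P the component of a
  acyclic-∷ : Acyclic F → ¬ Reach F a b → Acyclic ((a , b) ∷ F)
  acyclic-∷ acF ¬ab zero = ¬ab
  acyclic-∷ {F} {a} acF ¬ab (suc j) =
    add-bridge (λ e → component-invariant a (removeAt-⊆ F j e)) here ¬ab
      (proj₁ (component-invariant a (∈-lookup j))) (proj₂ (component-invariant a (∈-lookup j))) (acF j)

  acyclic-removeAt : Acyclic F → ∀ k → Acyclic (removeAt F k)
  acyclic-removeAt {F} acF k j r with removeAt-removeAt F k j
  ... | j′ , same , ⊆F = subst (λ e → ¬ Reach (removeAt F j′) (proj₁ e) (proj₂ e)) same (acF j′) (reach-mono ⊆F r)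

  acyclic-++ : Within U F → Within V G → Disjoint U V → Acyclic F → Acyclic G → Acyclic (F ++ G)
  acyclic-++ {F = []}          wF wG UV acF acG = acG
  acyclic-++ {F = (a , b) ∷ F} wF wG UV acF acG =
    acyclic-∷ (acyclic-++ (λ e → wF (there e)) wG UV (acyclic-removeAt acF zero) acG)
              (λ r → acF zero (reach-restrict (λ e → wF (there e)) wG UV (proj₁ (wF (here refl))) r))

  crossing-edge : (∀ z → Dec (P z)) → Reach F a b → P a → ¬ P b →
                  ∃[ s ] ∃[ t ] Adj F s t × P s × ¬ P t
  crossing-edge P? here Pa ¬Pb = ⊥-elim (¬Pb Pa)
  crossing-edge P? (step {v = x} e r) Pa ¬Pb with P? x
  ... | yes Px = crossing-edge P? r Px ¬Pb
  ... | no ¬Px = _ , x , e , Pa , ¬Px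

  steps-within : ∀ L → Within (_∈ L) (walkSteps L)
  steps-within (x ∷ y ∷ L) (here refl) = here refl , there (here refl)
  steps-within (x ∷ y ∷ L) (there e)   = Data.Product.map there there (steps-within (y ∷ L) e)

  reach-from-head : ∀ x L {z} → z ∈ x ∷ L → Reach (walkSteps (x ∷ L)) x z
  reach-from-head x L       (here refl) = here
  reach-from-head x (y ∷ L) (there z∈)  = step (inj₁ (here refl)) (reach-mono there (reach-from-head y L z∈))

  path-reach : ∀ {L} → x ∈ L → y ∈ L → Reach (walkSteps L) x y
  path-reach {L = z ∷ L} x∈ y∈ = reach-trans (reach-sym (reach-from-head z L x∈)) (reach-from-head z L y∈)

  path-acyclic : ∀ {L} → Unique L → Acyclic (walkSteps L)
  path-acyclic {[]}        _ ()
  path-acyclic {x ∷ []}    _ ()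
  path-acyclic {x ∷ y ∷ L} (x∉@(x≢y ∷ _) ∷ unique) =
    acyclic-∷ (path-acyclic unique) (λ r → x≢y (isolated (steps-within (y ∷ L)) (All¬⇒¬Any x∉) r))

  bridgedPaths : List (Node n) → List (Node n) → Node n → Node n → List (Edge n)
  bridgedPaths X Y a b = (a , b) ∷ (walkSteps X ++ walkSteps Y)

  -- if X and Y partition the nodes without repetitions, this is a spanning tree: it is
  -- connected through the bridge, and the bridge joins two disjoint acyclic paths
  bridgedPaths-spanning : ∀ {X Y} → Unique X → Unique Y → Disjoint (_∈ X) (_∈ Y) → (∀ z → z ∈ X ⊎ z ∈ Y) →
                          a ∈ X → b ∈ Y → IsSpanningTree (bridgedPaths X Y a b)
  bridgedPaths-spanning {a} {b} {X} {Y} uX uY XY cover a∈X b∈Y = connected , acyclic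
    where
    from-a : ∀ z → Reach (bridgedPaths X Y a b) a z
    from-a z with cover z
    ... | inj₁ z∈X = reach-mono (λ e → there (∈-++⁺ˡ e)) (path-reach a∈X z∈X)
    ... | inj₂ z∈Y = step (inj₁ (here refl)) (reach-mono (λ e → there (∈-++⁺ʳ (walkSteps X) e)) (path-reach b∈Y z∈Y))
    connected : Connected (bridgedPaths X Y a b)
    connected z w = reach-trans (reach-sym (from-a z)) (from-a w)
    acyclic : Acyclic (bridgedPaths X Y a b)
    acyclic = acyclic-∷ (acyclic-++ (steps-within X) (steps-within Y) XY (path-acyclic uX) (path-acyclic uY))
      (λ r → XY (reach-within (steps-within X) a∈X (reach-restrict (steps-within X) (steps-within Y) XY a∈X r)) b∈Y)

module _ {A : Set} where

  -- deduplicate keeps first occurrences, so it yields a sublist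
  deduplicate-⊑ : ∀ {R : A → A → Set} (R? : ∀ x y → Dec (R x y)) (L : List A) → deduplicate R? L ⊑ L
  deduplicate-⊑ R? []      = []
  deduplicate-⊑ R? (x ∷ L) = refl ∷ ⊆-trans (filter-⊆ _ (deduplicate R? L)) (deduplicate-⊑ R? L)

  filter-⊑-map : ∀ {P : A → Set} (P? : ∀ x → Dec (P x)) (f : A → A) → (∀ x → P x → f x ≡ x) →
                 ∀ L → filter P? L ⊑ map f L
  filter-⊑-map P? f fixes []      = []
  filter-⊑-map P? f fixes (x ∷ L) with P? x
  ... | yes Px = sym (fixes x Px) ∷ filter-⊑-map P? f fixes L
  ... | no _   = f x ∷ʳ filter-⊑-map P? f fixes L

module Cycles {n : ℕ} where

  returnSteps : Node n → List (Node n) → List (Edge n)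
  returnSteps z []          = []
  returnSteps z (a ∷ [])    = (a , z) ∷ []
  returnSteps z (a ∷ b ∷ L) = (a , b) ∷ returnSteps z (b ∷ L)

  -- cycleSteps (x ∷ L) is returnSteps x (x ∷ L); the local helper of cycleSteps
  -- is reached through the tail of cycleSteps (x ∷ b ∷ L)
  cycleSteps-unfold : ∀ x L → cycleSteps (x ∷ L) ≡ returnSteps x (x ∷ L)
  cycleSteps-unfold x []          = refl
  cycleSteps-unfold x (a ∷ [])    = refl
  cycleSteps-unfold x (a ∷ b ∷ L) = cong (λ E → (x , a) ∷ (a , b) ∷ tail E) (cycleSteps-unfold x (b ∷ L))
    where
    tail : List (Edge n) → List (Edge n)
    tail []      = []
    tail (_ ∷ E) = E

  steps-⊆-cycleSteps : ∀ X → walkSteps X ⊆ cycleSteps X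
  steps-⊆-cycleSteps (x ∷ L) e∈ = subst (_ ∈_) (sym (cycleSteps-unfold x L)) (steps-⊆-returnSteps x L e∈)
    where
    steps-⊆-returnSteps : ∀ a L → walkSteps (a ∷ L) ⊆ returnSteps x (a ∷ L)
    steps-⊆-returnSteps a (b ∷ L) (here e≡)  = here e≡
    steps-⊆-returnSteps a (b ∷ L) (there e∈) = there (steps-⊆-returnSteps b L e∈)

  returnSteps-edge : ∀ z L {p q} → (p , q) ∈ returnSteps z L →
                     (∃[ A ] ∃[ B ] L ≡ A ++ p ∷ q ∷ B) ⊎ (q ≡ z × ∃[ A ] L ≡ A ++ p ∷ [])
  returnSteps-edge z (a ∷ [])    (here refl) = inj₂ (refl , [] , refl)
  returnSteps-edge z (a ∷ b ∷ L) (here refl) = inj₁ ([] , L , refl)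
  returnSteps-edge z (a ∷ b ∷ L) (there e∈) with returnSteps-edge z (b ∷ L) e∈
  ... | inj₁ (A , B , L≡) = inj₁ (a ∷ A , B , cong (a ∷_) L≡)
  ... | inj₂ (q≡ , A , L≡) = inj₂ (q≡ , a ∷ A , cong (a ∷_) L≡)

  -- rotating a cycle X so that a given edge (p , q), p ≠ q, becomes its closing edge
  cycle-rotation : ∀ X {p q} → ¬ p ≡ q → (p , q) ∈ cycleSteps X →
                   ∃[ A ] ∃[ B ] ∃[ M ] X ≡ A ++ B × B ++ A ≡ q ∷ M ++ p ∷ []
  cycle-rotation (x ∷ L) {p} {q} p≢q e∈ with returnSteps-edge x (x ∷ L) (subst ((p , q) ∈_) (cycleSteps-unfold x L) e∈)
  ... | inj₁ (A , B , X≡) = A ++ p ∷ [] , q ∷ B , B ++ A ,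
          trans X≡ (sym (List.++-assoc A (p ∷ []) (q ∷ B))) , cong (q ∷_) (sym (List.++-assoc B A (p ∷ [])))
  ... | inj₂ (refl , [] , refl)    = ⊥-elim (p≢q refl)
  ... | inj₂ (refl , a ∷ A , refl) = x ∷ A ++ p ∷ [] , [] , A , sym (List.++-identityʳ _) , refl

module TourCost {n : ℕ} (c : Weight n) (metric : IsMetric c) where
  open IsMetric metric
  open Cycles
  open Graph using (Invariant; bridgedPaths)
  open ℚ.≤-Reasoning

  private variable
    K L : List (Node n)

  walkCost : List (Node n) → ℚ
  walkCost L = sumOf (edgeWeight c) (walkSteps L)

  pathCost : Node n → List (Node n) → Node n → ℚ
  pathCost a []      z = c a z
  pathCost a (b ∷ L) z = c a b + pathCost b L z

  tourCost-pathCost : ∀ x L → tourCost c (x ∷ L) ≡ pathCost x L x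
  tourCost-pathCost x L = trans (cong (sumOf (edgeWeight c)) (cycleSteps-unfold x L)) (returnCost x L)
    where
    returnCost : ∀ a L → sumOf (edgeWeight c) (returnSteps x (a ∷ L)) ≡ pathCost a L x
    returnCost a []      = ℚ.+-identityʳ _
    returnCost a (b ∷ L) = cong (c a b +_) (returnCost b L)

  pathCost-detour : ∀ a b L z → pathCost a L z ≤ c a b + pathCost b L z
  pathCost-detour a b []      z = triangle a b z
  pathCost-detour a b (d ∷ L) z = begin
    c a d + pathCost d L z           ≤⟨ ℚ.+-monoˡ-≤ (pathCost d L z) (triangle a b d) ⟩
    (c a b + c b d) + pathCost d L z ≡⟨ ℚ.+-assoc (c a b) (c b d) _ ⟩
    c a b + (c b d + pathCost d L z) ∎

  pathCost-endpoint : ∀ a L z w → pathCost a L z ≤ pathCost a L w + c w z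
  pathCost-endpoint a []      z w = triangle a w z
  pathCost-endpoint a (b ∷ L) z w = begin
    c a b + pathCost b L z           ≤⟨ ℚ.+-monoʳ-≤ (c a b) (pathCost-endpoint b L z w) ⟩
    c a b + (pathCost b L w + c w z) ≡⟨ ℚ.+-assoc (c a b) _ (c w z) ⟨
    (c a b + pathCost b L w) + c w z ∎

  pathCost-⊑ : K ⊑ L → ∀ a z → pathCost a K z ≤ pathCost a L z
  pathCost-⊑ []               a z = ℚ.≤-refl
  pathCost-⊑ (_∷ʳ_ {ys = L} y s) a z = ℚ.≤-trans (pathCost-⊑ s a z) (pathCost-detour a y L z)
  pathCost-⊑ (_∷_ {x = x} refl s) a z = ℚ.+-monoʳ-≤ (c a x) (pathCost-⊑ s x z)

  tourCost-nonneg : ∀ L → 0ℚ ≤ tourCost c L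
  tourCost-nonneg L = sumOf-nonneg (edgeWeight c) (λ e → nonneg (proj₁ e) (proj₂ e)) (cycleSteps L)

  tourCost-⊑ : K ⊑ L → tourCost c K ≤ tourCost c L
  tourCost-⊑ {[]} {L} s = tourCost-nonneg L
  tourCost-⊑ {x ∷ K} {.x ∷ L} (refl ∷ s) = begin
    tourCost c (x ∷ K) ≡⟨ tourCost-pathCost x K ⟩
    pathCost x K x     ≤⟨ pathCost-⊑ s x x ⟩
    pathCost x L x     ≡⟨ tourCost-pathCost x L ⟨
    tourCost c (x ∷ L) ∎
  tourCost-⊑ {x ∷ K} {y ∷ L} (.y ∷ʳ s) = begin
    tourCost c (x ∷ K)         ≡⟨ tourCost-pathCost x K ⟩
    pathCost x K x             ≤⟨ pathCost-endpoint x K x y ⟩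
    pathCost x K y + c y x     ≡⟨ ℚ.+-comm _ (c y x) ⟩
    pathCost y (x ∷ K) y       ≤⟨ pathCost-⊑ s y y ⟩
    pathCost y L y             ≡⟨ tourCost-pathCost y L ⟨
    tourCost c (y ∷ L)         ∎

  steps-≤-pathCost : ∀ a L z → walkCost (a ∷ L) ≤ pathCost a L z
  steps-≤-pathCost a []      z = nonneg a z
  steps-≤-pathCost a (b ∷ L) z = ℚ.+-monoʳ-≤ (c a b) (steps-≤-pathCost b L z)

  steps-≤-tourCost : ∀ L → walkCost L ≤ tourCost c L
  steps-≤-tourCost []      = ℚ.≤-refl
  steps-≤-tourCost (x ∷ L) = subst (_ ≤_) (sym (tourCost-pathCost x L)) (steps-≤-pathCost x L x)

  tourCost-open : ∀ x M y → tourCost c (x ∷ M ++ y ∷ []) ≡ walkCost (x ∷ M ++ y ∷ []) + c y x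
  tourCost-open x M y = trans (tourCost-pathCost x (M ++ y ∷ [])) (open-path x M)
    where
    open-path : ∀ a M → pathCost a (M ++ y ∷ []) x ≡ walkCost (a ∷ M ++ y ∷ []) + c y x
    open-path a []      = cong (_+ c y x) (sym (ℚ.+-identityʳ (c a y)))
    open-path a (b ∷ M) = trans (cong (c a b +_) (open-path b M)) (sym (ℚ.+-assoc (c a b) _ (c y x)))

  bridgedPaths-cost : ∀ X Y a b → weight c (bridgedPaths X Y a b) ≡ c a b + (walkCost X + walkCost Y)
  bridgedPaths-cost X Y a b = cong (c a b +_) (sumOf-++ (edgeWeight c) (walkSteps X) (walkSteps Y))

  pathCost-++ : ∀ a L b M z → pathCost a (L ++ b ∷ M) z ≡ pathCost a L b + pathCost b M z
  pathCost-++ a []      b M z = refl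
  pathCost-++ a (d ∷ L) b M z = trans (cong (c a d +_) (pathCost-++ d L b M z)) (sym (ℚ.+-assoc (c a d) _ _))

  tourCost-rotate : ∀ A B → tourCost c (A ++ B) ≡ tourCost c (B ++ A)
  tourCost-rotate []      B       = cong (tourCost c) (sym (List.++-identityʳ B))
  tourCost-rotate (x ∷ A) []      = cong (tourCost c) (List.++-identityʳ (x ∷ A))
  tourCost-rotate (x ∷ A) (y ∷ B) = begin-equality
    tourCost c (x ∷ A ++ y ∷ B)   ≡⟨ tourCost-pathCost x (A ++ y ∷ B) ⟩
    pathCost x (A ++ y ∷ B) x     ≡⟨ pathCost-++ x A y B x ⟩
    pathCost x A y + pathCost y B x ≡⟨ ℚ.+-comm (pathCost x A y) _ ⟩
    pathCost y B x + pathCost x A y ≡⟨ pathCost-++ y B x A y ⟨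
    pathCost y (B ++ x ∷ A) y     ≡⟨ tourCost-pathCost y (B ++ x ∷ A) ⟨
    tourCost c (y ∷ B ++ x ∷ A)   ∎

  closed-cost : ∀ {W} → Closed W → tourCost c W ≡ walkCost W
  closed-cost (x , inj₁ refl)       = cong (_+ 0ℚ) (diag x)
  closed-cost (x , inj₂ (M , refl)) =
    trans (tourCost-open x M x) (trans (cong (walkCost (x ∷ M ++ x ∷ []) +_) (diag x)) (ℚ.+-identityʳ _))

  closed-map : ∀ (f : Node n → Node n) {W} → Closed W → Closed (map f W)
  closed-map f (x , inj₁ refl)       = f x , inj₁ refl
  closed-map f (x , inj₂ (M , refl)) = f x , inj₂ (map f M , cong (f x ∷_) (List.map-++ f M (x ∷ [])))

  relabelEdge : (Node n → Node n) → Edge n → Edge n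
  relabelEdge f (a , b) = f a , f b

  relabelledCost : (Node n → Node n) → List (Edge n) → ℚ
  relabelledCost f = sumOf (λ e → edgeWeight c (relabelEdge f e))

  steps-map : ∀ f W → walkSteps (map f W) ≡ map (relabelEdge f) (walkSteps W)
  steps-map f []          = refl
  steps-map f (a ∷ [])    = refl
  steps-map f (a ∷ b ∷ W) = cong ((f a , f b) ∷_) (steps-map f (b ∷ W))

  relabelledCost-SameEdge : ∀ f {D E} → Pointwise SameEdge D E → relabelledCost f D ≡ relabelledCost f E
  relabelledCost-SameEdge f []                      = refl
  relabelledCost-SameEdge f {(a , b) ∷ _} (inj₁ (refl , refl) ∷ p) = cong (c (f a) (f b) +_) (relabelledCost-SameEdge f p)
  relabelledCost-SameEdge f {(a , b) ∷ _} (inj₂ (refl , refl) ∷ p) = cong₂ _+_ (symm (f a) (f b)) (relabelledCost-SameEdge f p)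

  euler-cost : ∀ {T W} → EulerCircuit (T ++ T) W → ∀ f →
               tourCost c (map f W) ≡ relabelledCost f T + relabelledCost f T
  euler-cost {T} {W} (closed , E , E↭TT , steps≡E) f = begin-equality
    tourCost c (map f W)                                   ≡⟨ closed-cost {map f W} (closed-map f closed) ⟩
    walkCost (map f W)                                     ≡⟨ cong (sumOf (edgeWeight c)) (steps-map f W) ⟩
    sumOf (edgeWeight c) (map (relabelEdge f) (walkSteps W)) ≡⟨ cong sumℚ (List.map-∘ (walkSteps W)) ⟨
    relabelledCost f (walkSteps W)                         ≡⟨ relabelledCost-SameEdge f steps≡E ⟩
    relabelledCost f E                                     ≡⟨ sumOf-↭ _ E↭TT ⟩
    relabelledCost f (T ++ T)                              ≡⟨ sumOf-++ _ T T ⟩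
    relabelledCost f T + relabelledCost f T                ∎

  shortcut-bound : ∀ {T W} → EulerCircuit (T ++ T) W → ∀ f → L ⊑ map f W →
                   tourCost c L ≤ relabelledCost f T + relabelledCost f T
  shortcut-bound {T = T} {W = W} euler f L⊑ = ℚ.≤-trans (tourCost-⊑ L⊑) (ℚ.≤-reflexive (euler-cost {T} {W} euler f))

  collapse : ∀ {P : Node n → Set} → (∀ z → Dec (P z)) → Node n → Node n → Node n
  collapse P? w z with P? z
  ... | yes _ = z
  ... | no _  = w

  module _ {P : Node n → Set} (P? : ∀ z → Dec (P z)) (w : Node n) where

    collapse-in : ∀ z → P z → collapse P? w z ≡ z
    collapse-in z Pz with P? z
    ... | yes _  = refl
    ... | no ¬Pz = ⊥-elim (¬Pz Pz)

    collapse-out : ∀ z → ¬ P z → collapse P? w z ≡ w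
    collapse-out z ¬Pz with P? z
    ... | yes Pz = ⊥-elim (¬Pz Pz)
    ... | no _   = refl

    -- if no edge of F joins P to its complement, collapsing the complement does not increase F's cost:
    -- edges inside P keep their cost and edges outside P become loops at w
    collapse-cost : ∀ F → Invariant F P → relabelledCost (collapse P? w) F ≤ weight c F
    collapse-cost F inv = sumOf-mono _ (edgeWeight c) F edge-bound
      where
      edge-bound : ∀ {e} → e ∈ F → edgeWeight c (relabelEdge (collapse P? w) e) ≤ edgeWeight c e
      edge-bound {x , y} e∈ = by-side (P? x)
        where
        by-side : Dec (P x) → c (collapse P? w x) (collapse P? w y) ≤ c x y
        by-side (yes Px) = ℚ.≤-reflexive (cong₂ c (collapse-in x Px) (collapse-in y (proj₁ (inv e∈) Px)))
        by-side (no ¬Px) = subst (_≤ c x y)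
          (sym (trans (cong₂ c (collapse-out x ¬Px) (collapse-out y (λ Py → ¬Px (proj₂ (inv e∈) Py)))) (diag w)))
          (nonneg x y)

module TreeCut {n : ℕ} (c : Weight n) (T : List (Edge n)) (mst : IsMST c T) (k : Fin (length T)) where
  open Graph

  u v : Node n
  u = proj₁ (lookup T k)
  v = proj₂ (lookup T k)

  T′ : List (Edge n)
  T′ = removeAt T k

  S : Node n → Set
  S = Reach T′ u

  -- acyclicity of T: without the edge (u , v), v is not reachable from u
  v∉S : ¬ S v
  v∉S = proj₂ (proj₁ mst) k

  adj-T : ∀ {a b} → Adj T a b → Adj T′ a b ⊎ (a ≡ u × b ≡ v) ⊎ (a ≡ v × b ≡ u)
  adj-T (inj₁ e) with ∈-removeAt T k e
  ... | inj₁ refl = inj₂ (inj₁ (refl , refl))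
  ... | inj₂ e′   = inj₁ (inj₁ e′)
  adj-T (inj₂ e) with ∈-removeAt T k e
  ... | inj₁ refl = inj₂ (inj₂ (refl , refl))
  ... | inj₂ e′   = inj₁ (inj₂ e′)

  reach-T : ∀ {a z} → Reach T a z → Reach T′ a z ⊎ S z ⊎ Reach T′ v z
  reach-T here = inj₁ here
  reach-T (step e r) with reach-T r | adj-T e
  ... | inj₁ r′ | inj₁ e′                  = inj₁ (step e′ r′)
  ... | inj₁ r′ | inj₂ (inj₁ (refl , refl)) = inj₂ (inj₂ r′)
  ... | inj₁ r′ | inj₂ (inj₂ (refl , refl)) = inj₂ (inj₁ r′)
  ... | inj₂ r′ | _                        = inj₂ r′

  -- since T is connected, every node is on u's side or reachable from v in T′
  two-sides : ∀ z → S z ⊎ Reach T′ v z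
  two-sides z with reach-T (proj₁ (proj₁ mst) u z)
  ... | inj₁ r = inj₁ r
  ... | inj₂ s = s

  -- cut property: the deleted edge is a cheapest edge leaving S, since otherwise
  -- exchanging it would give a cheaper spanning tree
  cut-property : ∀ {x y} → S x → ¬ S y → c u v ≤ c x y
  cut-property {x} {y} Sx ¬Sy = +-cancelʳ-≤ (c u v) (c x y) (weight c T′) exchange
    where
    from-u : ∀ z → Reach ((x , y) ∷ T′) u z
    from-u z with two-sides z | two-sides y
    ... | inj₁ Sz | _        = reach-mono there Sz
    ... | inj₂ vz | inj₁ Sy  = ⊥-elim (¬Sy Sy)
    ... | inj₂ vz | inj₂ vy  =
      reach-trans (reach-mono there Sx) (step (inj₁ (here refl)) (reach-mono there (reach-trans (reach-sym vy) vz)))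
    spanning : IsSpanningTree ((x , y) ∷ T′)
    spanning = (λ a b → reach-trans (reach-sym (from-u a)) (from-u b))
             , acyclic-∷ (acyclic-removeAt {F = T} (proj₂ (proj₁ mst)) k) (λ r → ¬Sy (reach-trans Sx r))
    exchange : c u v + weight c T′ ≤ c x y + weight c T′
    exchange = subst (_≤ c x y + weight c T′) (sumOf-removeAt (edgeWeight c) T k) (proj₂ mst _ spanning)

-- Two lists of nodes that could be the red and blue tours of a feasible solution:
-- together they list every node exactly once, and they separate the two nodes of each pair
record Complementary {n : ℕ} (X Y : List (Node n)) : Set where
  field
    unique-X  : Unique X
    unique-Y  : Unique Y
    disjoint  : Graph.Disjoint (_∈ X) (_∈ Y)
    cover     : ∀ z → z ∈ X ⊎ z ∈ Y
    partner-X : ∀ {i b} → (i , b) ∈ X → (i , not b) ∈ Y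
    partner-Y : ∀ {i b} → (i , b) ∈ Y → (i , not b) ∈ X

module _ {n : ℕ} where
  open Complementary

  complementary-swap : ∀ {X Y : List (Node n)} → Complementary X Y → Complementary Y X
  complementary-swap XY = record
    { unique-X = unique-Y XY ; unique-Y = unique-X XY ; disjoint = λ z∈Y z∈X → disjoint XY z∈X z∈Y
    ; cover = λ z → Data.Sum.swap (cover XY z) ; partner-X = partner-Y XY ; partner-Y = partner-X XY }

  complementary-↭ : ∀ {X X′ Y : List (Node n)} → Complementary X Y → X ↭ X′ → Complementary X′ Y
  complementary-↭ {X} {X′} XY X↭X′ = record
    { unique-X  = PermₛProps.Unique-resp-↭ (setoid (Node n)) (↭⇒↭ₛ X↭X′) (unique-X XY)
    ; unique-Y  = unique-Y XY
    ; disjoint  = λ z∈X′ → disjoint XY (back z∈X′)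
    ; cover     = λ z → Data.Sum.map₁ forth (cover XY z)
    ; partner-X = λ z∈X′ → partner-X XY (back z∈X′)
    ; partner-Y = λ z∈Y → forth (partner-Y XY z∈Y) }
    where
    forth : ∀ {z} → z ∈ X → z ∈ X′
    forth = Perm.∈-resp-↭ X↭X′
    back : ∀ {z} → z ∈ X′ → z ∈ X
    back = Perm.∈-resp-↭ (↭-sym X↭X′)

  feasible-complementary : (sol : Feasible n) → Complementary (Feasible.R sol) (Feasible.B sol)
  feasible-complementary sol = record
    { unique-X = proj₁ R-tour ; unique-Y = proj₁ B-tour
    ; disjoint = λ {z} z∈R z∈B → proj₁ (proj₂ B-tour z) z∈B (proj₁ (proj₂ R-tour z) z∈R)
    ; cover = cover′
    ; partner-X = λ {i} {b} z∈R → proj₂ (proj₂ B-tour (i , not b)) (Bool.not-¬ (sym (proj₁ (proj₂ R-tour (i , b)) z∈R)) ∘ sym)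
    ; partner-Y = λ {i} {b} z∈B → proj₂ (proj₂ R-tour (i , not b)) (sym (Bool.¬-not (proj₁ (proj₂ B-tour (i , b)) z∈B ∘ sym))) }
    where
    open Feasible sol
    cover′ : ∀ z → z ∈ R ⊎ z ∈ B
    cover′ (i , b) with b Bool.≟ coloring i
    ... | yes red  = inj₁ (proj₂ (proj₂ R-tour (i , b)) red)
    ... | no ¬red  = inj₂ (proj₂ (proj₂ B-tour (i , b)) ¬red)

-- The analysis of Algorithm 2 on a fixed instance, comparing its output with any pair of
-- complementary tours X, Y, assuming that the side S of the cut is decidable

module Analysis {n : ℕ} (c : Weight n) (metric : IsMetric c)
                (T : List (Edge n)) (mst : IsMST c T) (k : Fin (length T)) (max-edge : IsMaxEdge c T k)
                (col : Coloring n) (respects : RespectsCut T k col)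
                (W : List (Node n)) (euler : EulerCircuit (T ++ T) W)
                (S? : ∀ z → Dec (Reach (removeAt T k) (proj₁ (lookup T k)) z)) where
  open IsMetric metric
  open Graph
  open Cycles
  open TourCost c metric
  open TreeCut c T mst k
  open Complementary
  open ℚ.≤-Reasoning
  open import Data.List.Membership.DecPropositional (_≟N_ {n}) using (_∈?_)

  private variable
    X Y : List (Node n)
    p q x z : Node n

  blue? : ∀ z → Dec (IsBlue col z)
  blue? z = ¬? (proj₂ z Bool.≟ col (proj₁ z))

  red? : ∀ z → Dec (IsRed col z)
  red? z = proj₂ z Bool.≟ col (proj₁ z)

  Cb Cr : List (Node n)
  Cb = bluePart col (shortcut W)
  Cr = redPart col (shortcut W)

  shortcut-⊑ : shortcut W ⊑ W
  shortcut-⊑ = deduplicate-⊑ _≟N_ W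

  -- both returned tours shortcut the Euler circuit of the doubled tree
  double-tree : ∀ {a} → weight c T ≤ a → tourCost c Cb ⊔ tourCost c Cr ≤ a + a
  double-tree {a} T≤a = ℚ.⊔-lub (bound Cb (filter-⊆ blue? _)) (bound Cr (filter-⊆ red? _))
    where
    bound : ∀ L → L ⊑ shortcut W → tourCost c L ≤ a + a
    bound L L⊑ = ℚ.≤-trans (shortcut-bound {T = T} euler id (subst (L ⊑_) (sym (List.map-id W)) (⊆-trans L⊑ shortcut-⊑)))
                           (ℚ.+-mono-≤ T≤a T≤a)

  Crosses : Edge n → Set
  Crosses (p , q) = (S p × ¬ S q) ⊎ (¬ S p × S q)

  crosses? : ∀ e → Dec (Crosses e)
  crosses? (p , q) = (S? p ×-dec ¬? (S? q)) ⊎-dec (¬? (S? p) ×-dec S? q)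

  crosses-≢ : Crosses (p , q) → ¬ p ≡ q
  crosses-≢ (inj₁ (Sp , ¬Sq)) refl = ¬Sq Sp
  crosses-≢ (inj₂ (¬Sp , Sq)) refl = ¬Sp Sq

  tree-edge-≤ : ∀ {s t} → Adj T s t → c s t ≤ c u v
  tree-edge-≤ (inj₁ e) = subst (λ d → edgeWeight c d ≤ c u v) (sym (lookup-index e)) (max-edge (index e))
  tree-edge-≤ {s} {t} (inj₂ e) = subst (_≤ c u v) (symm t s) (tree-edge-≤ (inj₁ e))

  crossing-≥ : Crosses (p , q) → c u v ≤ c p q
  crossing-≥ (inj₁ (Sp , ¬Sq)) = cut-property Sp ¬Sq
  crossing-≥ {p} {q} (inj₂ (¬Sp , Sq)) = subst (c u v ≤_) (symm q p) (cut-property Sq ¬Sp)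

  -- a tree edge joins X to Y: on the tree path from p ∈ X to its partner, some edge leaves X
  leaving-edge : Complementary X Y → p ∈ X → ∃[ s ] ∃[ t ] Adj T s t × s ∈ X × t ∈ Y
  leaving-edge {X} {Y} {p} XY p∈X
    with crossing-edge (_∈? X) (proj₁ (proj₁ mst) p (proj₁ p , not (proj₂ p))) p∈X
                       (λ p̄∈X → disjoint XY p̄∈X (partner-X XY p∈X))
  ... | s , t , st∈T , s∈X , t∉X = s , t , st∈T , s∈X , Data.Sum.[ (λ t∈X → ⊥-elim (t∉X t∈X)) , id ] (cover XY t)

  -- Case 1, with the crossing edge (p , q) closing the tour X = q ∷ M ++ [p]: the path
  -- q … p and a Hamiltonian path of Y, joined by a tree edge (s , t) leaving X, form a
  -- spanning tree, and c s t ≤ c u v ≤ c p q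
  closing-edge-crosses : ∀ M → Complementary (q ∷ M ++ p ∷ []) Y → Crosses (p , q) →
                         weight c T ≤ (walkCost (q ∷ M ++ p ∷ []) + c p q) + tourCost c Y
  closing-edge-crosses {q} {p} {Y} M XY pq-crosses with leaving-edge XY (there (∈-++⁺ʳ M (here refl)))
  ... | s , t , st∈T , s∈X , t∈Y = begin
    weight c T                                    ≤⟨ proj₂ mst _ spanning ⟩
    weight c (bridgedPaths X₀ Y s t)              ≡⟨ bridgedPaths-cost X₀ Y s t ⟩
    c s t + (walkCost X₀ + walkCost Y)         ≤⟨ ℚ.+-mono-≤ (ℚ.≤-trans (tree-edge-≤ st∈T) (crossing-≥ pq-crosses))
                                                                (ℚ.+-monoʳ-≤ (walkCost X₀) (steps-≤-tourCost Y)) ⟩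
    c p q + (walkCost X₀ + tourCost c Y)         ≡⟨ ℚ.+-assoc (c p q) _ _ ⟨
    (c p q + walkCost X₀) + tourCost c Y         ≡⟨ cong (_+ tourCost c Y) (ℚ.+-comm (c p q) _) ⟩
    (walkCost X₀ + c p q) + tourCost c Y         ∎
    where
    X₀ = q ∷ M ++ p ∷ []
    spanning : IsSpanningTree (bridgedPaths X₀ Y s t)
    spanning = bridgedPaths-spanning (unique-X XY) (unique-Y XY) (disjoint XY) (cover XY) s∈X t∈Y

  crossing-case : Complementary X Y → (p , q) ∈ cycleSteps X → Crosses (p , q) →
                  weight c T ≤ tourCost c X + tourCost c Y
  crossing-case {X} {Y} {p} {q} XY pq∈X pq-crosses with cycle-rotation X (crosses-≢ pq-crosses) pq∈X
  ... | A , B , M , X≡AB , BA≡ = begin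
    weight c T                                        ≤⟨ closing-edge-crosses M X′Y pq-crosses ⟩
    (walkCost (q ∷ M ++ p ∷ []) + c p q) + tourCost c Y ≡⟨ cong (_+ tourCost c Y) X-cost ⟨
    tourCost c X + tourCost c Y                       ∎
    where
    X′Y : Complementary (q ∷ M ++ p ∷ []) Y
    X′Y = complementary-↭ XY (subst₂ _↭_ (sym X≡AB) BA≡ (Perm.++-comm A B))
    X-cost : tourCost c X ≡ walkCost (q ∷ M ++ p ∷ []) + c p q
    X-cost = begin-equality
      tourCost c X                      ≡⟨ cong (tourCost c) X≡AB ⟩
      tourCost c (A ++ B)               ≡⟨ tourCost-rotate A B ⟩
      tourCost c (B ++ A)               ≡⟨ cong (tourCost c) BA≡ ⟩
      tourCost c (q ∷ M ++ p ∷ [])      ≡⟨ tourCost-open q M p ⟩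
      walkCost (q ∷ M ++ p ∷ []) + c p q ∎

  NoCrossing : List (Node n) → Set
  NoCrossing X = ∀ {e} → e ∈ cycleSteps X → ¬ Crosses e

  same-side : NoCrossing X → x ∈ X → z ∈ X → S x → S z
  same-side {X} none x∈X z∈X = invariant-reach along-X (reach-mono (steps-⊆-cycleSteps X) (path-reach x∈X z∈X))
    where
    along-X : Invariant (cycleSteps X) S
    along-X {a} {b} e = (λ Sa → decidable-stable (S? b) (λ ¬Sb → none e (inj₁ (Sa , ¬Sb))))
                      , (λ Sb → decidable-stable (S? a) (λ ¬Sa → none e (inj₂ (¬Sa , Sb))))

  colour-class-bound : ∀ {P : Node n → Set} (P? : ∀ z → Dec (P z)) (w : Node n) →
    Invariant T′ P → c (collapse P? w u) (collapse P? w v) ≡ 0ℚ →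
    tourCost c (filter P? (shortcut W)) ≤ weight c T′ + weight c T′
  colour-class-bound P? w inv uv≡0 = ℚ.≤-trans (shortcut-bound {T = T} euler f class⊑) (ℚ.+-mono-≤ T-bound T-bound)
    where
    f : Node n → Node n
    f = collapse P? w
    class⊑ : filter P? (shortcut W) ⊑ map f W
    class⊑ = ⊆-trans (filter⁺ P? P? (λ { refl Pz → Pz }) shortcut-⊑) (filter-⊑-map P? f (collapse-in P? w) W)
    T-bound : relabelledCost f T ≤ weight c T′
    T-bound = begin
      relabelledCost f T                  ≡⟨ sumOf-removeAt _ T k ⟩
      c (f u) (f v) + relabelledCost f T′ ≡⟨ cong (_+ relabelledCost f T′) uv≡0 ⟩
      0ℚ + relabelledCost f T′            ≡⟨ ℚ.+-identityˡ _ ⟩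
      relabelledCost f T′                 ≤⟨ collapse-cost P? w T′ inv ⟩
      weight c T′                         ∎

  -- the paths through X and Y joined by the deleted edge form a spanning tree, so c(T′) ≤ c(X) + c(Y)
  deleted-edge-bridge : Complementary X Y → u ∈ X → v ∈ Y → weight c T′ ≤ tourCost c X + tourCost c Y
  deleted-edge-bridge {X} {Y} XY u∈X v∈Y = +-cancelʳ-≤ _ _ (c u v) (begin
    weight c T′ + c u v                    ≡⟨ ℚ.+-comm (weight c T′) (c u v) ⟩
    c u v + weight c T′                    ≡⟨ sumOf-removeAt (edgeWeight c) T k ⟨
    weight c T                             ≤⟨ proj₂ mst _ (bridgedPaths-spanning (unique-X XY) (unique-Y XY) (disjoint XY) (cover XY) u∈X v∈Y) ⟩
    weight c (bridgedPaths X Y u v)        ≡⟨ bridgedPaths-cost X Y u v ⟩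
    c u v + (walkCost X + walkCost Y)      ≤⟨ ℚ.+-monoʳ-≤ (c u v) (ℚ.+-mono-≤ (steps-≤-tourCost X) (steps-≤-tourCost Y)) ⟩
    c u v + (tourCost c X + tourCost c Y)  ≡⟨ ℚ.+-comm (c u v) _ ⟩
    (tourCost c X + tourCost c Y) + c u v  ∎)

  -- if S is blue and its complement red, each returned tour costs at most twice T′:
  -- the blue tour collapses the red side onto u, the red tour the blue side onto v
  cut-colouring-bound : (∀ z → S z → IsBlue col z) → (∀ z → ¬ S z → IsRed col z) →
                        tourCost c Cb ⊔ tourCost c Cr ≤ weight c T′ + weight c T′
  cut-colouring-bound S⇒blue ¬S⇒red = ℚ.⊔-lub blue-bound red-bound
    where
    blue⇒S : IsBlue col z → S z
    blue⇒S {z} blue = decidable-stable (S? z) (λ ¬Sz → blue (¬S⇒red z ¬Sz))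
    red⇒¬S : IsRed col z → ¬ S z
    red⇒¬S {z} red Sz = S⇒blue z Sz red
    blue-bound : tourCost c Cb ≤ weight c T′ + weight c T′
    blue-bound = colour-class-bound blue? u (invariant-⇔ (S⇒blue _) blue⇒S (component-invariant u))
      (trans (cong₂ c (collapse-in blue? u u (S⇒blue u here)) (collapse-out blue? u v (λ blue → blue (¬S⇒red v v∉S))))
             (diag u))
    red-bound : tourCost c Cr ≤ weight c T′ + weight c T′
    red-bound = colour-class-bound red? v (invariant-⇔ (¬S⇒red _) red⇒¬S (invariant-¬ (component-invariant u)))
      (trans (cong₂ c (collapse-out red? v u (λ red → red⇒¬S red here)) (collapse-in red? v v (¬S⇒red v v∉S)))
             (diag v))

  -- if no tour edge crosses the cut, S is exactly the tour X through u; by RespectsCut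
  -- S is blue (the partners of its nodes lie in Y) and its complement is red
  separated-sides : Complementary X Y → u ∈ X → NoCrossing X → NoCrossing Y →
                    v ∈ Y × (∀ z → S z → IsBlue col z) × (∀ z → ¬ S z → IsRed col z)
  separated-sides {X} {Y} XY u∈X noX noY = v∈Y , S⇒blue , ¬S⇒red
    where
    X⇒S : z ∈ X → S z
    X⇒S z∈X = same-side noX u∈X z∈X here
    v∈Y : v ∈ Y
    v∈Y = Data.Sum.[ (λ v∈X → ⊥-elim (v∉S (X⇒S v∈X))) , id ] (cover XY v)
    Y⇒¬S : z ∈ Y → ¬ S z
    Y⇒¬S z∈Y Sz = v∉S (same-side noY z∈Y v∈Y Sz)
    S⇒X : S z → z ∈ X
    S⇒X {z} Sz = Data.Sum.[ id , (λ z∈Y → ⊥-elim (Y⇒¬S z∈Y Sz)) ] (cover XY z)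
    S⇒blue : ∀ z → S z → IsBlue col z
    S⇒blue (i , b) Sz = respects i b Sz (Y⇒¬S (partner-X XY (S⇒X Sz)))
    ¬S⇒red : ∀ z → ¬ S z → IsRed col z
    ¬S⇒red (i , b) ¬Sz = Bool.not-injective (Bool.¬-not partner-blue)
      where
      partner∈X : (i , not b) ∈ X
      partner∈X = partner-Y XY (Data.Sum.[ (λ z∈X → ⊥-elim (¬Sz (X⇒S z∈X))) , id ] (cover XY (i , b)))
      partner-blue : IsBlue col (i , not b)
      partner-blue = respects i (not b) (X⇒S partner∈X)
                       (λ S-back → ¬Sz (subst (λ b′ → S (i , b′)) (Bool.not-involutive b) S-back))

  separated-case : Complementary X Y → u ∈ X → NoCrossing X → NoCrossing Y →
    tourCost c Cb ⊔ tourCost c Cr ≤ (tourCost c X + tourCost c Y) + (tourCost c X + tourCost c Y)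
  separated-case {X} {Y} XY u∈X noX noY with separated-sides XY u∈X noX noY
  ... | v∈Y , S⇒blue , ¬S⇒red =
    ℚ.≤-trans (cut-colouring-bound S⇒blue ¬S⇒red) (ℚ.+-mono-≤ T′-bound T′-bound)
    where
    T′-bound : weight c T′ ≤ tourCost c X + tourCost c Y
    T′-bound = deleted-edge-bridge XY u∈X v∈Y

  algorithm-bound : Complementary X Y →
    tourCost c Cb ⊔ tourCost c Cr ≤ (tourCost c X + tourCost c Y) + (tourCost c X + tourCost c Y)
  algorithm-bound {X} {Y} XY with any? crosses? (cycleSteps X) | any? crosses? (cycleSteps Y)
  ... | yes crossing-in-X | _ with find crossing-in-X
  ...   | _ , e∈X , crosses = double-tree (crossing-case XY e∈X crosses)
  algorithm-bound {X} {Y} XY | no _ | yes crossing-in-Y with find crossing-in-Y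
  ...   | _ , e∈Y , crosses = double-tree (ℚ.≤-trans (crossing-case (complementary-swap XY) e∈Y crosses)
                                                     (ℚ.≤-reflexive (ℚ.+-comm (tourCost c Y) _)))
  algorithm-bound {X} {Y} XY | no ¬crossing-in-X | no ¬crossing-in-Y with cover XY u
  ...   | inj₁ u∈X = separated-case XY u∈X (λ e∈ → ¬crossing-in-X ∘ lose e∈) (λ e∈ → ¬crossing-in-Y ∘ lose e∈)
  ...   | inj₂ u∈Y = subst (λ a → _ ≤ a + a) (ℚ.+-comm (tourCost c Y) _)
                       (separated-case (complementary-swap XY) u∈Y (λ e∈ → ¬crossing-in-Y ∘ lose e∈)
                                                                   (λ e∈ → ¬crossing-in-X ∘ lose e∈))

¬¬-decidable : ∀ n (P : Node n → Set) → ¬ ¬ (∀ z → Dec (P z))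
¬¬-decidable ℕ.zero    P ¬dec = ¬dec (λ { (() , _) })
¬¬-decidable (ℕ.suc n) P ¬dec =
  ¬¬-excluded-middle λ dec-false → ¬¬-excluded-middle λ dec-true →
  ¬¬-decidable n (λ { (i , b) → P (suc i , b) }) λ dec-rest →
  ¬dec (λ { (zero , false) → dec-false ; (zero , true) → dec-true ; (suc i , b) → dec-rest (i , b) })

assume-decidable : ∀ {n} {G : Set} → Dec G → (P : Node n → Set) → ((∀ z → Dec (P z)) → G) → G
assume-decidable {n} G? P prove = decidable-stable G? (λ ¬G → ¬¬-decidable n P (λ P? → ¬G (prove P?)))

four-times : ∀ m → four * m ≡ (m + m) + (m + m)
four-times m = trans (ℚ.*-distribʳ-+ m (1ℚ + 1ℚ) (1ℚ + 1ℚ)) (cong₂ _+_ twice twice)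
  where
  twice : (1ℚ + 1ℚ) * m ≡ m + m
  twice = trans (ℚ.*-distribʳ-+ m 1ℚ 1ℚ) (cong₂ _+_ (ℚ.*-identityˡ m) (ℚ.*-identityˡ m))

theorem6 : (n : ℕ) → 2 ∣ n → (c : Weight n) → IsMetric c →
    (T : List (Edge n)) → IsMST c T →
    (k : Fin (length T)) → IsMaxEdge c T k →
    (col : Coloring n) → RespectsCut T k col →
    (W : List (Node n)) → EulerCircuit (T ++ T) W →
    (sol : Feasible n) →
    tourCost c (bluePart col (shortcut W)) ⊔ tourCost c (redPart col (shortcut W))
      ≤ four * mmCost c sol
theorem6 n _ c metric T mst k max-edge col respects W euler sol =
  assume-decidable (_ ℚ.≤? _) (Reach (removeAt T k) (proj₁ (lookup T k))) λ S? → begin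
    tourCost c Cb ⊔ tourCost c Cr ≤⟨ Analysis.algorithm-bound c metric T mst k max-edge col respects W euler S?
                                       (feasible-complementary sol) ⟩
    (cR + cB) + (cR + cB)          ≤⟨ ℚ.+-mono-≤ sum≤2max sum≤2max ⟩
    (m + m) + (m + m)              ≡⟨ four-times m ⟨
    four * m                       ∎
  where
  open ℚ.≤-Reasoning
  open Feasible sol using (R; B)
  Cb Cr : List (Node n)
  Cb = bluePart col (shortcut W)
  Cr = redPart col (shortcut W)
  cR cB m : ℚ
  cR = tourCost c R
  cB = tourCost c B
  m = mmCost c sol
  sum≤2max : cR + cB ≤ m + m
  sum≤2max = ℚ.+-mono-≤ (ℚ.p≤p⊔q cR cB) (ℚ.p≤q⊔p cR cB)
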